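{- Let $(S,R)$ be a Catalan pair of type 1 on a finite set $X$, and let $M$ be the Fishburn matrix of the poset $R$ (which is an interval order). For a cell $c$ of $M$ let $X_c$ be the set of elements represented by $c$. Then: (a) for every nonzero cell $c$, the restriction of $S$ to $X_c$ is a linear order; (b) if $c$ and $d$ are distinct nonzero cells with $c$ weakly SW from $d$, then $xSy$ for all $x\in X_c$, $y\in X_d$; (c) no other pairs are $S$-comparable: if $x,y\in X$ are $S$-comparable, then either $x,y$ are represented by the same cell, or the cell of one is weakly SW from the cell of the other.
   Context: A relation on $X$ is a subset of $X\times X$; $xRy$ means $(x,y)\in R$; $x,y$ are $R$-comparable if $xRy$ or $yRx$. A partial order is an irreflexive transitive relation. A Catalan pair of type 1 is a pair $(S,R)$ of relations on a finite set $X$ such that: (C1a) $S$ and $R$ are partial orders; (C1b) any two distinct elements are comparable by exactly one of $S$, $R$; (C1c) for distinct $x,y,z$ with $xSy$ and $yRz$ we have $xRz$. (It is known that then $R$ is a poset avoiding $\mathbf{2+2}$ and $\mathbf{N}$, in particular an interval order.) Interval order: poset with no four elements $a,b,c,d$ with $a<b$, $c<d$ and all other pairs incomparable. Its Fishburn matrix: take the unique minimal interval representation $x\mapsto[l_x,r_x]$ with positive integer endpoints, $x\prec y$ iff $r_x<l_y$, and every $k\in\{1,\dots,m\}$ being both a left and a right endpoint; $M$ is $m\times m$ with $M_{i,j}=|\{x:[l_x,r_x]=[i,j]\}|$, rows numbered top to bottom, and $x$ is represented by cell $(i,j)$. For cells $c=(i,j)$, $c'=(i',j')$ (with $i\le j$,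 $i'\le j'$): $c$ is South of $c'$ if $i>i'$, $j=j'$; West of $c'$ if $i=i'$, $j<j'$; strictly SW of $c'$ if $i>i'$, $j<j'$; weakly SW if South, West or strictly SW. -}

module Defs where

open import Data.Nat using (ℕ; _≤_; _<_; _>_)
open import Data.Fin using (Fin)
open import Data.Product using (_×_; _,_; ∃)
open import Data.Sum using (_⊎_)
open import Relation.Nullary using (¬_)
open import Relation.Binary.PropositionalEquality using (_≡_; _≢_)

HRel : ℕ → Set₁
HRel n = Fin n → Fin n → Set

module _ {n : ℕ} where

  Comparable : HRel n → Fin n → Fin n → Set
  Comparable R x y = R x y ⊎ R y x

  IsPartialOrder : HRel n → Set
  IsPartialOrder R = (∀ x → ¬ R x x) × (∀ x y z → R x y → R y z → R x z)

  record IsCatalanPair1 (S R : HRel n) : Set where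
    field
      S-po : IsPartialOrder S
      R-po : IsPartialOrder R
      exactlyOne : ∀ x y → x ≢ y →
        (Comparable S x y × ¬ Comparable R x y) ⊎ (Comparable R x y × ¬ Comparable S x y)
      mixed : ∀ x y z → x ≢ y → y ≢ z → x ≢ z →
        S x y → R y z → R x z

  record IsMinimalIntervalRep (R : HRel n) (m : ℕ) (l r : Fin n → ℕ) : Set where
    field
      l-pos   : ∀ x → 1 ≤ l x
      l≤r     : ∀ x → l x ≤ r x
      r≤m     : ∀ x → r x ≤ m
      rep     : ∀ x y → R x y → r x < l y
      rep⁻¹   : ∀ x y → r x < l y → R x y
      allLeft  : ∀ k → 1 ≤ k → k ≤ m → ∃ λ x → l x ≡ k
      allRight : ∀ k → 1 ≤ k → k ≤ m → ∃ λ x → r x ≡ k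

-- Cells (i , j) of the Fishburn matrix (row i, column j).
Cell : Set
Cell = ℕ × ℕ

South : Cell → Cell → Set
South (i , j) (i' , j') = i > i' × j ≡ j'

West : Cell → Cell → Set
West (i , j) (i' , j') = i ≡ i' × j < j'

StrictlySW : Cell → Cell → Set
StrictlySW (i , j) (i' , j') = i > i' × j < j'

WeaklySW : Cell → Cell → Set
WeaklySW c c' = South c c' ⊎ West c c' ⊎ StrictlySW c c'

module _ {n : ℕ} where

  cellOf : (l r : Fin n → ℕ) → Fin n → Cell
  cellOf l r x = (l x , r x)

  InCell : (l r : Fin n → ℕ) → Cell → Fin n → Set
  InCell l r c x = cellOf l r x ≡ c

  -- c is a nonzero cell of M, i.e. M_c ≠ 0, i.e. X_c nonempty
  Nonzero : (l r : Fin n → ℕ) → Cell → Set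
  Nonzero l r c = ∃ λ x → InCell l r c x

  IsLinearOn : HRel n → (Fin n → Set) → Set
  IsLinearOn S P =
      (∀ x → P x → ¬ S x x)
    × (∀ x y z → P x → P y → P z → S x y → S y z → S x z)
    × (∀ x y → P x → P y → x ≢ y → Comparable S x y)

-- By (C1b) two distinct elements are S-comparable
-- exactly when their intervals overlap. The heart of the proof is that x S y forces the interval
-- of x inside that of y (l y ≤ l x and r x ≤ r y): otherwise minimality of the representation
-- supplies an element w ending at l x, or beginning at r x, and (C1c) together with the
-- transitivity of S turns w into an R-relation contradicting x S y. Containment of intervals is
-- precisely "equal or weakly SW" for the cells, which gives (c); (a) and (b) follow since cells in
-- weakly SW position carry nested, hence overlapping, intervals, and y S x would force the
-- reverse containment.
module Submission where

open import Defs
open import Data.Nat using (ℕ; _≤_; _<_)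
open import Data.Nat.Properties
  using (≤-refl; ≤-reflexive; ≤-trans; ≤-antisym; <⇒≤; <-≤-trans; <-irrefl; ≮⇒≥;
         m≤n⇒m<n∨m≡n)
open import Data.Fin using (Fin; _≟_)
open import Data.Product using (_×_; _,_; proj₁; proj₂)
open import Data.Sum using (_⊎_; inj₁; inj₂)
open import Data.Empty using (⊥)
open import Function using (_∘_)
open import Relation.Nullary using (¬_; yes; no; contradiction)
open import Relation.Binary.PropositionalEquality using (_≡_; _≢_; refl; sym; cong; cong₂; subst)

WeaklySW⇒≤ : ∀ {i j i′ j′} → WeaklySW (i , j) (i′ , j′) → i′ ≤ i × j ≤ j′
WeaklySW⇒≤ (inj₁ (i′<i , refl))        = <⇒≤ i′<i , ≤-refl
WeaklySW⇒≤ (inj₂ (inj₁ (refl , j<j′))) = ≤-refl , <⇒≤ j<j′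
WeaklySW⇒≤ (inj₂ (inj₂ (i′<i , j<j′))) = <⇒≤ i′<i , <⇒≤ j<j′

≤⇒≡⊎WeaklySW : ∀ {i j i′ j′} → i′ ≤ i → j ≤ j′ → (i , j) ≡ (i′ , j′) ⊎ WeaklySW (i , j) (i′ , j′)
≤⇒≡⊎WeaklySW i′≤i j≤j′ with m≤n⇒m<n∨m≡n i′≤i | m≤n⇒m<n∨m≡n j≤j′
... | inj₁ i′<i | inj₁ j<j′ = inj₂ (inj₂ (inj₂ (i′<i , j<j′)))
... | inj₁ i′<i | inj₂ j≡j′ = inj₂ (inj₁ (i′<i , j≡j′))
... | inj₂ i′≡i | inj₁ j<j′ = inj₂ (inj₂ (inj₁ (sym i′≡i , j<j′)))
... | inj₂ i′≡i | inj₂ j≡j′ = inj₁ (cong₂ _,_ (sym i′≡i) j≡j′)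

module CatalanPair {n : ℕ} {S R : HRel n} (cp : IsCatalanPair1 S R) where
  open IsCatalanPair1 cp

  S-irrefl : ∀ x → ¬ S x x
  S-irrefl = proj₁ S-po

  S-trans : ∀ x y z → S x y → S y z → S x z
  S-trans = proj₂ S-po

  S⇒≢ : ∀ {x y} → S x y → x ≢ y
  S⇒≢ {x} Sxx refl = S-irrefl x Sxx

  R⇒≢ : ∀ {x y} → R x y → x ≢ y
  R⇒≢ {x} Rxx refl = proj₁ R-po x Rxx

  S⇒¬R : ∀ {x y} → S x y → ¬ Comparable R x y
  S⇒¬R {x} {y} Sxy with exactlyOne x y (S⇒≢ Sxy)
  ... | inj₁ (_ , ¬R) = ¬R
  ... | inj₂ (_ , ¬S) = contradiction (inj₁ Sxy) ¬S

  ¬R⇒S-comparable : ∀ {x y} → x ≢ y → ¬ Comparable R x y → Comparable S x y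
  ¬R⇒S-comparable {x} {y} x≢y ¬R with exactlyOne x y x≢y
  ... | inj₁ (S-cmp , _) = S-cmp
  ... | inj₂ (R-cmp , _) = contradiction R-cmp ¬R

module FishburnCells {n : ℕ} {S R : HRel n} (cp : IsCatalanPair1 S R)
                     {m : ℕ} {l r : Fin n → ℕ} (ir : IsMinimalIntervalRep R m l r) where
  open IsCatalanPair1 cp
  open IsMinimalIntervalRep ir
  open CatalanPair cp

  overlap⇒¬R : ∀ {x y} → l y ≤ r x → ¬ R x y
  overlap⇒¬R ly≤rx Rxy = <-irrefl refl (<-≤-trans (rep _ _ Rxy) ly≤rx)

  nested⇒¬R-comparable : ∀ {x y} → l y ≤ l x → r x ≤ r y → ¬ Comparable R x y
  nested⇒¬R-comparable ly≤lx rx≤ry (inj₁ Rxy) = overlap⇒¬R (≤-trans ly≤lx (l≤r _)) Rxy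
  nested⇒¬R-comparable ly≤lx rx≤ry (inj₂ Ryx) = overlap⇒¬R (≤-trans (l≤r _) rx≤ry) Ryx

  -- Witness: an element w with r w = l x; it lies R-below y but overlaps x.
  S⇒l-antitone : ∀ {x y} → S x y → l y ≤ l x
  S⇒l-antitone {x} {y} Sxy = ≮⇒≥ λ lx<ly →
    let (w , rw≡lx) = allRight (l x) (l-pos x) (≤-trans (l≤r x) (r≤m x))
    in  refute w rw≡lx (rep⁻¹ w y (subst (_< l y) (sym rw≡lx) lx<ly))
    where
    refute : ∀ w → r w ≡ l x → R w y → ⊥
    refute w rw≡lx Rwy with w ≟ x
    ... | yes refl = S⇒¬R Sxy (inj₁ Rwy)
    ... | no w≢x with ¬R⇒S-comparable w≢x (λ where
            (inj₁ Rwx) → overlap⇒¬R (≤-reflexive (sym rw≡lx)) Rwx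
            (inj₂ Rxw) → overlap⇒¬R (≤-trans (l≤r w) (subst (_≤ r x) (sym rw≡lx) (l≤r x))) Rxw)
    ...   | inj₁ Swx = S⇒¬R (S-trans w x y Swx Sxy) (inj₁ Rwy)
    ...   | inj₂ Sxw = S⇒¬R Sxy (inj₁ (mixed x w y (w≢x ∘ sym) (R⇒≢ Rwy) (S⇒≢ Sxy) Sxw Rwy))

  -- Witness: an element z with l z = r x; then y R z, and (C1c) would give x R z.
  S⇒r-monotone : ∀ {x y} → S x y → r x ≤ r y
  S⇒r-monotone {x} {y} Sxy = ≮⇒≥ λ ry<rx →
    let (z , lz≡rx) = allLeft (r x) (≤-trans (l-pos x) (l≤r x)) (r≤m x)
    in  refute z lz≡rx (rep⁻¹ y z (subst (r y <_) (sym lz≡rx) ry<rx))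
    where
    refute : ∀ z → l z ≡ r x → R y z → ⊥
    refute z lz≡rx Ryz with x ≟ z
    ... | yes refl = S⇒¬R Sxy (inj₂ Ryz)
    ... | no x≢z = <-irrefl (sym lz≡rx) (rep x z (mixed x y z (S⇒≢ Sxy) (R⇒≢ Ryz) x≢z Sxy Ryz))

  S⇒≡⊎WeaklySW : ∀ {x y} → S x y → cellOf l r x ≡ cellOf l r y ⊎ WeaklySW (cellOf l r x) (cellOf l r y)
  S⇒≡⊎WeaklySW Sxy = ≤⇒≡⊎WeaklySW (S⇒l-antitone Sxy) (S⇒r-monotone Sxy)

  S-linearOnCell : ∀ c → IsLinearOn S (InCell l r c)
  S-linearOnCell c = (λ x _ → S-irrefl x) , (λ x y z _ _ _ → S-trans x y z) , total
    where
    total : ∀ x y → InCell l r c x → InCell l r c y → x ≢ y → Comparable S x y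
    total x y refl cy≡cx x≢y = ¬R⇒S-comparable x≢y
      (nested⇒¬R-comparable (≤-reflexive (cong proj₁ cy≡cx)) (≤-reflexive (cong proj₂ (sym cy≡cx))))

  S-fromNested : ∀ {x y} → cellOf l r x ≢ cellOf l r y → l y ≤ l x → r x ≤ r y → S x y
  S-fromNested cx≢cy ly≤lx rx≤ry
    with ¬R⇒S-comparable (cx≢cy ∘ cong (cellOf l r)) (nested⇒¬R-comparable ly≤lx rx≤ry)
  ... | inj₁ Sxy = Sxy
  ... | inj₂ Syx = contradiction (cong₂ _,_ (≤-antisym (S⇒l-antitone Syx) ly≤lx)
                                            (≤-antisym rx≤ry (S⇒r-monotone Syx))) cx≢cy

  S-fromWeaklySW : ∀ {c d} → c ≢ d → WeaklySW c d →
                   ∀ x y → InCell l r c x → InCell l r d y → S x y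
  S-fromWeaklySW c≢d c-SW-d x y refl refl =
    S-fromNested c≢d (proj₁ (WeaklySW⇒≤ c-SW-d)) (proj₂ (WeaklySW⇒≤ c-SW-d))

lemma2p2 : (n : ℕ) (S R : HRel n) → IsCatalanPair1 S R →
           (m : ℕ) (l r : Fin n → ℕ) → IsMinimalIntervalRep R m l r →
           ((c : Cell) → Nonzero l r c → IsLinearOn S (InCell l r c))
           × ((c d : Cell) → c ≢ d → Nonzero l r c → Nonzero l r d → WeaklySW c d →
              (x y : Fin n) → InCell l r c x → InCell l r d y → S x y)
           × ((x y : Fin n) → Comparable S x y →
              cellOf l r x ≡ cellOf l r y
              ⊎ WeaklySW (cellOf l r x) (cellOf l r y)
              ⊎ WeaklySW (cellOf l r y) (cellOf l r x))
lemma2p2 n S R cp m l r ir =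
  (λ c _ → S-linearOnCell c) , (λ c d c≢d _ _ → S-fromWeaklySW c≢d) , S-comparable⇒cells
  where
  open FishburnCells cp ir

  S-comparable⇒cells : (x y : Fin n) → Comparable S x y →
                        cellOf l r x ≡ cellOf l r y
                        ⊎ WeaklySW (cellOf l r x) (cellOf l r y)
                        ⊎ WeaklySW (cellOf l r y) (cellOf l r x)
  S-comparable⇒cells x y (inj₁ Sxy) with S⇒≡⊎WeaklySW Sxy
  ... | inj₁ same = inj₁ same
  ... | inj₂ x-SW-y = inj₂ (inj₁ x-SW-y)
  S-comparable⇒cells x y (inj₂ Syx) with S⇒≡⊎WeaklySW Syx
  ... | inj₁ same = inj₁ (sym same)
  ... | inj₂ y-SW-x = inj₂ (inj₂ y-SW-x)
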